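{- For all integers $a,b\geq 1$ there exists a shiftable $SMR(4b+2,(2a+1)(4b+2);4a+2,2)$.
   Context: A signed magic rectangle $SMR(m,n;r,s)$ is an $m\times n$ array, some of whose cells are filled with integers and the others empty, such that exactly $r$ cells in every row and exactly $s$ cells in every column are filled (so $mr=ns$), every element of $X$ appears exactly once in the array, and the sum of the entries of each row and of each column is zero, where (for $mr$ even) $X=\{\pm1,\pm2,\ldots,\pm mr/2\}$. An array is shiftable if every row and every column contains the same number of positive entries as negative entries. -}

module Defs where

open import Data.Nat as ℕ using (ℕ; zero; suc)
open import Data.Nat.DivMod using (_/_)
open import Data.Integer as ℤ using (ℤ; ∣_∣; +_; +0)
open import Data.Fin using (Fin; zero; suc)
open import Data.Maybe using (Maybe; just; nothing)
open import Data.Bool using (Bool; true; false; if_then_else_)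
open import Data.Product using (_×_)
open import Relation.Binary.PropositionalEquality using (_≡_)
open import Relation.Nullary.Decidable using (⌊_⌋)

-- A partially filled m × n array of integers: `nothing` = empty cell.
Array : ℕ → ℕ → Set
Array m n = Fin m → Fin n → Maybe ℤ

count : ∀ {n} → (Fin n → Bool) → ℕ
count {zero}  p = 0
count {suc n} p = (if p zero then 1 else 0) ℕ.+ count (λ i → p (suc i))

sumF : ∀ {n} → (Fin n → ℤ) → ℤ
sumF {zero}  f = +0
sumF {suc n} f = f zero ℤ.+ sumF (λ i → f (suc i))

val : Maybe ℤ → ℤ
val nothing  = +0
val (just x) = x

filled : Maybe ℤ → Bool
filled nothing  = false
filled (just _) = true

positive : Maybe ℤ → Bool
positive nothing  = false
positive (just x) = ⌊ + 1 ℤ.≤? x ⌋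

negative : Maybe ℤ → Bool
negative nothing  = false
negative (just x) = ⌊ x ℤ.≤? ℤ.- + 1 ⌋

isJust≡ : ℤ → Maybe ℤ → Bool
isJust≡ x nothing  = false
isJust≡ x (just y) = ⌊ y ℤ.≟ x ⌋

InX : ℕ → ℤ → Set
InX k x = (1 ℕ.≤ ∣ x ∣) × (∣ x ∣ ℕ.≤ k)

-- Signed magic rectangle SMR(m,n;r,s) (used with m r even)
record IsSMR (m n r s : ℕ) (A : Array m n) : Set where
  field
    rowFilled   : ∀ i → count (λ j → filled (A i j)) ≡ r
    colFilled   : ∀ j → count (λ i → filled (A i j)) ≡ s
    entriesInX  : ∀ i j x → A i j ≡ just x → InX ((m ℕ.* r) / 2) x
    eachOnce    : ∀ x → InX ((m ℕ.* r) / 2) x →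
                  sumF (λ i → + count (λ j → isJust≡ x (A i j))) ≡ + 1
    rowSum      : ∀ i → sumF (λ j → val (A i j)) ≡ +0
    colSum      : ∀ j → sumF (λ i → val (A i j)) ≡ +0

record Shiftable {m n : ℕ} (A : Array m n) : Set where
  field
    rowBal : ∀ i → count (λ j → positive (A i j)) ≡ count (λ j → negative (A i j))
    colBal : ∀ j → count (λ i → positive (A i j)) ≡ count (λ i → negative (A i j))

{-# OPTIONS --safe #-}
module Submission where

-- Let column j of the array hold exactly the pair ±(j+1), with +(j+1) in row pos j and −(j+1) in
-- row neg j ≠ pos j.  Columns are then automatically shiftable and zero-sum, every symbol occurs once,
-- and the array is a shiftable SMR(m,n;2h,2) as soon as every row meets h columns through pos and h
-- through neg and the labels j+1 met through pos and through neg have the same sum.  Such balanced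
-- pairings combine side by side, with the labels of the second shifted by n₁ (a row gains n₁ times its
-- degree on both sides, and the two degrees agree), and block-diagonally when h agrees.  From four
-- explicit small blocks, B66 ‖ (a−1)·B64 stacked diagonally over b−1 copies of B46 ‖ (a−1)·B44 has
-- 4b+2 rows and 2a+1 entries of each sign in every row.

open import Defs
import Data.Nat.Properties as ℕₚ
open import Algebra.Properties.Semiring.Sum ℕₚ.+-*-semiring
  using (sum-syntax; ∑-distrib-+; ∑-comm; sum-cong-≗; sum-replicate-zero; *-distribˡ-sum; *-distribʳ-sum)
open import Data.Bool.Base using (Bool; if_then_else_)
open import Data.Fin using (#_)
open import Data.Fin.Base using (Fin; zero; suc; toℕ; fromℕ<; _↑ˡ_; _↑ʳ_; splitAt; join)
open import Data.Fin.Properties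
  using (_≟_; all?; toℕ-↑ˡ; toℕ-↑ʳ; ↑ˡ-injective; ↑ʳ-injective; splitAt-↑ˡ; splitAt-↑ʳ; join-splitAt;
         toℕ<n; toℕ-fromℕ<; toℕ-injective)
open import Data.Integer.Base as ℤ using (ℤ; -[1+_]; +0)
import Data.Integer.Properties as ℤₚ
import Data.Integer.Tactic.RingSolver as ℤ-Solver
open import Data.Maybe.Base using (Maybe; just; nothing)
open import Data.Nat.Base as ℕ using (ℕ; zero; suc; _+_; _*_; _<_; _≥_; s≤s; z≤n)
open import Data.Nat.DivMod using (_/_; m*n/n≡m)
open import Data.Nat.Tactic.RingSolver using (solve-∀)
open import Data.Product.Base using (Σ; _×_; _,_; proj₁; proj₂)
open import Data.Sum.Base using ([_,_])
open import Data.Vec.Base using (Vec; []; _∷_; lookup)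
open import Data.Vec.Functional using (_++_)
open import Data.Vec.Functional.Properties using (lookup-++ˡ; lookup-++ʳ)
open import Data.Vec.Functional.Relation.Binary.Pointwise.Properties using (++⁺)
open import Function.Base using (_∘_)
open import Function.Bundles using (mk⇔)
open import Function.Definitions using (Injective)
open import Relation.Binary.PropositionalEquality
  using (_≡_; _≢_; refl; sym; trans; cong; cong₂; subst; module ≡-Reasoning)
open import Relation.Nullary using (¬_; Dec; does; yes; no; contradiction)
open import Relation.Nullary.Decidable
  using (does-⇔; dec-false; isYes≗does; map′; ¬?; _×-dec_; True; toWitness)

private
  variable
    m n m₁ m₂ n₁ n₂ h : ℕ

𝟙 : Bool → ℕ
𝟙 b = if b then 1 else 0

count≡∑ : (p : Fin n → Bool) → count p ≡ ∑[ i < n ] 𝟙 (p i)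
count≡∑ {zero}  p = refl
count≡∑ {suc n} p = cong (𝟙 (p zero) +_) (count≡∑ (p ∘ suc))

∑-const : ∀ n c → ∑[ i < n ] c ≡ n * c
∑-const zero    c = refl
∑-const (suc n) c = cong (c +_) (∑-const n c)

∑-↑ : ∀ m (f : Fin (m + n) → ℕ) → ∑[ k < m + n ] f k ≡ ∑[ i < m ] f (i ↑ˡ n) + ∑[ j < n ] f (m ↑ʳ j)
∑-↑ zero    f = refl
∑-↑ (suc m) f = trans (cong (f zero +_) (∑-↑ m (f ∘ suc))) (sym (ℕₚ.+-assoc (f zero) _ _))

∑-*-shift : ∀ c (f g : Fin n → ℕ) →
            ∑[ j < n ] (f j * (c + g j)) ≡ ∑[ j < n ] (f j * g j) + c * ∑[ j < n ] f j
∑-*-shift {n} c f g = begin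
  ∑[ j < n ] (f j * (c + g j))                   ≡⟨ sum-cong-≗ (λ j → distrib c (f j) (g j)) ⟩
  ∑[ j < n ] (f j * g j + c * f j)               ≡⟨ ∑-distrib-+ (λ j → f j * g j) (λ j → c * f j) ⟩
  ∑[ j < n ] (f j * g j) + ∑[ j < n ] (c * f j)  ≡⟨ cong (∑[ j < n ] (f j * g j) +_) (sym (*-distribˡ-sum c f)) ⟩
  ∑[ j < n ] (f j * g j) + c * ∑[ j < n ] f j    ∎
  where
  open ≡-Reasoning
  distrib : ∀ c x y → x * (c + y) ≡ x * y + c * x
  distrib = solve-∀

δ : Fin m → Fin m → ℕ
δ i a = 𝟙 (does (i ≟ a))

∑-δ : (a : Fin n) → ∑[ i < n ] δ i a ≡ 1
∑-δ {suc n} zero    = cong suc (sum-replicate-zero n)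
∑-δ {suc n} (suc a) = ∑-δ a

∑-δ-* : (a : Fin n) (w : ℕ) → ∑[ i < n ] (δ i a * w) ≡ w
∑-δ-* a w = trans (sym (*-distribʳ-sum w (λ i → δ i a))) (trans (cong (_* w) (∑-δ a)) (ℕₚ.*-identityˡ w))

∑-δ-toℕ : ∀ {k} → k < n → ∑[ j < n ] 𝟙 (does (toℕ j ℕₚ.≟ k)) ≡ 1
∑-δ-toℕ {n} {k} k<n = trans (sum-cong-≗ toℕ-δ) (∑-δ (fromℕ< k<n))
  where
  toℕ-δ : ∀ j → 𝟙 (does (toℕ j ℕₚ.≟ k)) ≡ δ j (fromℕ< k<n)
  toℕ-δ j = cong 𝟙 (does-⇔ (mk⇔ (λ e → toℕ-injective (trans e (sym (toℕ-fromℕ< k<n))))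
                                (λ e → trans (cong toℕ e) (toℕ-fromℕ< k<n)))
                           (toℕ j ℕₚ.≟ k) (j ≟ fromℕ< k<n))

sumF-⊖ : (x : Fin n → ℤ) (f g : Fin n → ℕ) → (∀ i → x i ≡ ℤ.+ f i ℤ.- ℤ.+ g i) →
         sumF x ≡ ℤ.+ ∑[ i < n ] f i ℤ.- ℤ.+ ∑[ i < n ] g i
sumF-⊖ {zero}  x f g e = refl
sumF-⊖ {suc n} x f g e = begin
  x zero ℤ.+ sumF (x ∘ suc)
    ≡⟨ cong₂ ℤ._+_ (e zero) (sumF-⊖ (x ∘ suc) (f ∘ suc) (g ∘ suc) (e ∘ suc)) ⟩
  (ℤ.+ f zero ℤ.- ℤ.+ g zero) ℤ.+ (ℤ.+ F ℤ.- ℤ.+ G)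
    ≡⟨ regroup (ℤ.+ f zero) (ℤ.+ g zero) (ℤ.+ F) (ℤ.+ G) ⟩
  (ℤ.+ f zero ℤ.+ ℤ.+ F) ℤ.- (ℤ.+ g zero ℤ.+ ℤ.+ G)
    ≡⟨ sym (cong₂ ℤ._-_ (ℤₚ.pos-+ (f zero) F) (ℤₚ.pos-+ (g zero) G)) ⟩
  ℤ.+ (f zero + F) ℤ.- ℤ.+ (g zero + G)
    ∎
  where
  open ≡-Reasoning
  F = ∑[ i < n ] f (suc i)
  G = ∑[ i < n ] g (suc i)
  regroup : ∀ a b c d → (a ℤ.- b) ℤ.+ (c ℤ.- d) ≡ (a ℤ.+ c) ℤ.- (b ℤ.+ d)
  regroup = ℤ-Solver.solve-∀

sumF-+ : (f : Fin n → ℕ) → sumF (λ i → ℤ.+ f i) ≡ ℤ.+ ∑[ i < n ] f i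
sumF-+ {zero}  f = refl
sumF-+ {suc n} f = trans (cong (ℤ._+_ (ℤ.+ f zero)) (sumF-+ (f ∘ suc))) (sym (ℤₚ.pos-+ (f zero) _))

label : Fin n → ℕ
label j = suc (toℕ j)

label-↑ʳ : ∀ m (j : Fin n) → label (m ↑ʳ j) ≡ m + label j
label-↑ʳ m j = trans (cong suc (toℕ-↑ʳ m j)) (sym (ℕₚ.+-suc m (toℕ j)))

degree : (Fin n → Fin m) → Fin m → ℕ
degree {n} f i = ∑[ j < n ] δ i (f j)

weight : (Fin n → Fin m) → Fin m → ℕ
weight {n} f i = ∑[ j < n ] (δ i (f j) * label j)

degree-++ : (f : Fin n₁ → Fin m) (g : Fin n₂ → Fin m) (i : Fin m) →
            degree (f ++ g) i ≡ degree f i + degree g i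
degree-++ {n₁} f g i = trans (∑-↑ n₁ _)
  (cong₂ _+_ (sum-cong-≗ (λ j → cong (δ i) (lookup-++ˡ f g j)))
             (sum-cong-≗ (λ j → cong (δ i) (lookup-++ʳ f g j))))

weight-++ : (f : Fin n₁ → Fin m) (g : Fin n₂ → Fin m) (i : Fin m) →
            weight (f ++ g) i ≡ weight f i + (weight g i + n₁ * degree g i)
weight-++ {n₁} {n₂ = n₂} f g i = begin
  weight (f ++ g) i
    ≡⟨ ∑-↑ n₁ _ ⟩
  ∑[ j < n₁ ] (δ i ((f ++ g) (j ↑ˡ n₂)) * label (j ↑ˡ n₂)) +
  ∑[ j < n₂ ] (δ i ((f ++ g) (n₁ ↑ʳ j)) * label (n₁ ↑ʳ j))
    ≡⟨ cong₂ _+_ (sum-cong-≗ (λ j → cong₂ (λ x l → δ i x * l) (lookup-++ˡ f g j) (cong suc (toℕ-↑ˡ j n₂))))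
                 (sum-cong-≗ (λ j → cong₂ (λ x l → δ i x * l) (lookup-++ʳ f g j) (label-↑ʳ n₁ j))) ⟩
  weight f i + ∑[ j < n₂ ] (δ i (g j) * (n₁ + label j))
    ≡⟨ cong (weight f i +_) (∑-*-shift n₁ (δ i ∘ g) label) ⟩
  weight f i + (weight g i + n₁ * degree g i) ∎
  where open ≡-Reasoning

module _ {e : Fin m₁ → Fin m} (e-injective : Injective _≡_ _≡_ e) (f : Fin n → Fin m₁) (i : Fin m₁) where

  δ-inj : ∀ j → δ (e i) (e (f j)) ≡ δ i (f j)
  δ-inj j = cong 𝟙 (does-⇔ (mk⇔ e-injective (cong e)) (e i ≟ e (f j)) (i ≟ f j))

  degree-∘ : degree (e ∘ f) (e i) ≡ degree f i
  degree-∘ = sum-cong-≗ δ-inj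

  weight-∘ : weight (e ∘ f) (e i) ≡ weight f i
  weight-∘ = sum-cong-≗ (λ j → cong (_* label j) (δ-inj j))

module _ (f : Fin n → Fin m) {i : Fin m} (i∉f : ∀ j → i ≢ f j) where

  δ-∉ : ∀ j → δ i (f j) ≡ 0
  δ-∉ j = cong 𝟙 (dec-false (i ≟ f j) (i∉f j))

  degree-∉ : degree f i ≡ 0
  degree-∉ = trans (sum-cong-≗ δ-∉) (sum-replicate-zero n)

  weight-∉ : weight f i ≡ 0
  weight-∉ = trans (sum-cong-≗ (λ j → cong (_* label j) (δ-∉ j))) (sum-replicate-zero n)

↑ˡ≢↑ʳ : (i : Fin m) (j : Fin n) → i ↑ˡ n ≢ m ↑ʳ j
↑ˡ≢↑ʳ {m} {n} i j eq
  with () ← trans (sym (splitAt-↑ˡ m i n)) (trans (cong (splitAt m) eq) (splitAt-↑ʳ m n j))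

↑-split : {P : Fin (m + n) → Set} → (∀ i → P (i ↑ˡ n)) → (∀ j → P (m ↑ʳ j)) → ∀ k → P k
↑-split {m} {n} {P} left right k =
  subst P (join-splitAt m n k) ([_,_] {C = P ∘ join m n} left right (splitAt m k))

_⊕_ : (Fin n₁ → Fin m₁) → (Fin n₂ → Fin m₂) → Fin (n₁ + n₂) → Fin (m₁ + m₂)
_⊕_ {m₁ = m₁} {m₂ = m₂} f g = (λ j → f j ↑ˡ m₂) ++ (λ j → m₁ ↑ʳ g j)

module _ (f : Fin n₁ → Fin m₁) (g : Fin n₂ → Fin m₂) where
  private
    f↑ : Fin n₁ → Fin (m₁ + m₂)
    f↑ j = f j ↑ˡ m₂
    g↑ : Fin n₂ → Fin (m₁ + m₂)
    g↑ j = m₁ ↑ʳ g j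
    g↑∌ : ∀ i j → i ↑ˡ m₂ ≢ g↑ j
    g↑∌ i j = ↑ˡ≢↑ʳ i (g j)
    f↑∌ : ∀ i j → m₁ ↑ʳ i ≢ f↑ j
    f↑∌ i j e = ↑ˡ≢↑ʳ (f j) i (sym e)

  degree-⊕ˡ : ∀ i → degree (f ⊕ g) (i ↑ˡ m₂) ≡ degree f i
  degree-⊕ˡ i = trans (degree-++ f↑ g↑ (i ↑ˡ m₂))
    (trans (cong₂ _+_ (degree-∘ (↑ˡ-injective m₂ _ _) f i) (degree-∉ g↑ (g↑∌ i))) (ℕₚ.+-identityʳ _))

  degree-⊕ʳ : ∀ i → degree (f ⊕ g) (m₁ ↑ʳ i) ≡ degree g i
  degree-⊕ʳ i = trans (degree-++ f↑ g↑ (m₁ ↑ʳ i))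
    (cong₂ _+_ (degree-∉ f↑ (f↑∌ i)) (degree-∘ (↑ʳ-injective m₁ _ _) g i))

  weight-⊕ˡ : ∀ i → weight (f ⊕ g) (i ↑ˡ m₂) ≡ weight f i
  weight-⊕ˡ i = begin
    weight (f ⊕ g) (i ↑ˡ m₂)  ≡⟨ weight-++ f↑ g↑ (i ↑ˡ m₂) ⟩
    weight f↑ (i ↑ˡ m₂) + (weight g↑ (i ↑ˡ m₂) + n₁ * degree g↑ (i ↑ˡ m₂))
      ≡⟨ cong₂ _+_ (weight-∘ (↑ˡ-injective m₂ _ _) f i)
               (cong₂ (λ w d → w + n₁ * d) (weight-∉ g↑ (g↑∌ i)) (degree-∉ g↑ (g↑∌ i))) ⟩
    weight f i + n₁ * 0       ≡⟨ cong (weight f i +_) (ℕₚ.*-zeroʳ n₁) ⟩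
    weight f i + 0            ≡⟨ ℕₚ.+-identityʳ _ ⟩
    weight f i                ∎
    where open ≡-Reasoning

  weight-⊕ʳ : ∀ i → weight (f ⊕ g) (m₁ ↑ʳ i) ≡ weight g i + n₁ * degree g i
  weight-⊕ʳ i = trans (weight-++ f↑ g↑ (m₁ ↑ʳ i))
    (cong₂ _+_ (weight-∉ f↑ (f↑∌ i))
               (cong₂ (λ w d → w + n₁ * d) (weight-∘ (↑ʳ-injective m₁ _ _) g i)
                                           (degree-∘ (↑ʳ-injective m₁ _ _) g i)))

-- pos j and neg j are the rows of +(j+1) and −(j+1) in column j of toArray: degree counts the entries
-- of one sign in a row and weight adds up their absolute values.
record IsBalanced (h : ℕ) (pos neg : Fin n → Fin m) : Set where
  field
    separated   : ∀ j → pos j ≢ neg j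
    pos-regular : ∀ i → degree pos i ≡ h
    neg-regular : ∀ i → degree neg i ≡ h
    balanced    : ∀ i → weight pos i ≡ weight neg i

record BalancedPairing (m n h : ℕ) : Set where
  field
    pos neg    : Fin n → Fin m
    isBalanced : IsBalanced h pos neg
  open IsBalanced isBalanced public

open BalancedPairing

shifted-balanced : ∀ c (P : BalancedPairing m n h) (i : Fin m) →
                   weight (pos P) i + c * degree (pos P) i ≡ weight (neg P) i + c * degree (neg P) i
shifted-balanced c P i =
  cong₂ (λ w d → w + c * d) (balanced P i) (trans (pos-regular P i) (sym (neg-regular P i)))

_‖_ : ∀ {h₁ h₂} → BalancedPairing m n₁ h₁ → BalancedPairing m n₂ h₂ →
      BalancedPairing m (n₁ + n₂) (h₁ + h₂)
_‖_ {n₁ = n₁} P Q = record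
  { pos = pos P ++ pos Q
  ; neg = neg P ++ neg Q
  ; isBalanced = record
    { separated   = ++⁺ _≢_ (separated P) (separated Q)
    ; pos-regular = λ i → trans (degree-++ (pos P) (pos Q) i) (cong₂ _+_ (pos-regular P i) (pos-regular Q i))
    ; neg-regular = λ i → trans (degree-++ (neg P) (neg Q) i) (cong₂ _+_ (neg-regular P i) (neg-regular Q i))
    ; balanced    = λ i → trans (weight-++ (pos P) (pos Q) i)
        (trans (cong₂ _+_ (balanced P i) (shifted-balanced n₁ Q i)) (sym (weight-++ (neg P) (neg Q) i)))
    }
  }

_⊞_ : BalancedPairing m₁ n₁ h → BalancedPairing m₂ n₂ h → BalancedPairing (m₁ + m₂) (n₁ + n₂) h
_⊞_ {m₁} {n₁} {m₂ = m₂} P Q = record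
  { pos = pos P ⊕ pos Q
  ; neg = neg P ⊕ neg Q
  ; isBalanced = record
    { separated   = ++⁺ _≢_ (λ j e → separated P j (↑ˡ-injective m₂ _ _ e))
                            (λ j e → separated Q j (↑ʳ-injective m₁ _ _ e))
    ; pos-regular = ↑-split (λ i → trans (degree-⊕ˡ (pos P) (pos Q) i) (pos-regular P i))
                            (λ i → trans (degree-⊕ʳ (pos P) (pos Q) i) (pos-regular Q i))
    ; neg-regular = ↑-split (λ i → trans (degree-⊕ˡ (neg P) (neg Q) i) (neg-regular P i))
                            (λ i → trans (degree-⊕ʳ (neg P) (neg Q) i) (neg-regular Q i))
    ; balanced    = ↑-split
        (λ i → trans (weight-⊕ˡ (pos P) (pos Q) i)
                 (trans (balanced P i) (sym (weight-⊕ˡ (neg P) (neg Q) i))))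
        (λ i → trans (weight-⊕ʳ (pos P) (pos Q) i)
                 (trans (shifted-balanced n₁ Q i) (sym (weight-⊕ʳ (neg P) (neg Q) i))))
    }
  }

‖-power : ∀ k → BalancedPairing m n h → BalancedPairing m (k * n) (k * h)
‖-power zero    P = record
  { pos = λ () ; neg = λ ()
  ; isBalanced = record
    { separated = λ () ; pos-regular = λ _ → refl ; neg-regular = λ _ → refl ; balanced = λ _ → refl } }
‖-power (suc k) P = P ‖ ‖-power k P

⊞-power : ∀ k → BalancedPairing m n h → BalancedPairing (k * m) (k * n) h
⊞-power zero    P = record
  { pos = λ () ; neg = λ ()
  ; isBalanced = record
    { separated = λ () ; pos-regular = λ () ; neg-regular = λ () ; balanced = λ () } }
⊞-power (suc k) P = P ⊞ ⊞-power k P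

isBalanced? : ∀ h (pos neg : Fin n → Fin m) → Dec (IsBalanced h pos neg)
isBalanced? h pos neg = map′
  (λ (s , p , q , b) → record { separated = s ; pos-regular = p ; neg-regular = q ; balanced = b })
  (λ B → IsBalanced.separated B , IsBalanced.pos-regular B , IsBalanced.neg-regular B , IsBalanced.balanced B)
  (all? (λ j → ¬? (pos j ≟ neg j)) ×-dec all? (λ i → degree pos i ℕₚ.≟ h) ×-dec
   all? (λ i → degree neg i ℕₚ.≟ h) ×-dec all? (λ i → weight pos i ℕₚ.≟ weight neg i))

fromColumns : (cs : Vec (Fin m × Fin m) n) →
              {True (isBalanced? h (proj₁ ∘ lookup cs) (proj₂ ∘ lookup cs))} → BalancedPairing m n h
fromColumns cs {ok} = record
  { pos = proj₁ ∘ lookup cs ; neg = proj₂ ∘ lookup cs ; isBalanced = toWitness ok }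

-- Bmr is a shiftable SMR(m, mr/2; r, 2); the k-th pair gives the rows of +k and −k.
B44 : BalancedPairing 4 8 2
B44 = fromColumns
  ( (# 3 , # 1) ∷ (# 1 , # 3) ∷ (# 1 , # 3) ∷ (# 3 , # 1) ∷ (# 2 , # 0) ∷ (# 0 , # 2) ∷
    (# 0 , # 2) ∷ (# 2 , # 0) ∷ [])

B46 : BalancedPairing 4 12 3
B46 = fromColumns
  ( (# 2 , # 1) ∷ (# 0 , # 2) ∷ (# 2 , # 0) ∷ (# 0 , # 3) ∷ (# 3 , # 0) ∷ (# 3 , # 2) ∷
    (# 1 , # 2) ∷ (# 1 , # 3) ∷ (# 1 , # 3) ∷ (# 3 , # 0) ∷ (# 2 , # 1) ∷ (# 0 , # 1) ∷ [])

B64 : BalancedPairing 6 12 2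
B64 = fromColumns
  ( (# 1 , # 0) ∷ (# 3 , # 1) ∷ (# 5 , # 3) ∷ (# 0 , # 3) ∷ (# 3 , # 5) ∷ (# 0 , # 4) ∷
    (# 4 , # 1) ∷ (# 1 , # 5) ∷ (# 2 , # 0) ∷ (# 5 , # 2) ∷ (# 4 , # 2) ∷ (# 2 , # 4) ∷ [])

B66 : BalancedPairing 6 18 3
B66 = fromColumns
  ( (# 2 , # 3) ∷ (# 0 , # 2) ∷ (# 2 , # 4) ∷ (# 1 , # 0) ∷ (# 1 , # 2) ∷ (# 3 , # 1) ∷
    (# 5 , # 2) ∷ (# 3 , # 5) ∷ (# 4 , # 1) ∷ (# 2 , # 1) ∷ (# 5 , # 3) ∷ (# 3 , # 0) ∷
    (# 4 , # 5) ∷ (# 4 , # 3) ∷ (# 0 , # 5) ∷ (# 1 , # 4) ∷ (# 0 , # 4) ∷ (# 5 , # 0) ∷ [])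

cell : {A B : Set} → Dec A → Dec B → ℕ → Maybe ℤ
cell (yes _) _       k = just (ℤ.+ suc k)
cell (no _)  (yes _) k = just -[1+ k ]
cell (no _)  (no _)  k = nothing

positive-cell : {A B : Set} (a? : Dec A) (b? : Dec B) (k : ℕ) → 𝟙 (positive (cell a? b? k)) ≡ 𝟙 (does a?)
positive-cell (yes _) _       k = refl
positive-cell (no _)  (yes _) k = refl
positive-cell (no _)  (no _)  k = refl

isJust⁺-cell : {A B : Set} (a? : Dec A) (b? : Dec B) (k k′ : ℕ) →
               𝟙 (isJust≡ (ℤ.+ suc k′) (cell a? b? k)) ≡ 𝟙 (does a?) * 𝟙 (does (k ℕₚ.≟ k′))
isJust⁺-cell (yes _) _       k k′ =
  trans (cong 𝟙 (isYes≗does (ℤ.+ suc k ℤₚ.≟ ℤ.+ suc k′))) (sym (ℕₚ.+-identityʳ _))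
isJust⁺-cell (no _)  (yes _) k k′ = refl
isJust⁺-cell (no _)  (no _)  k k′ = refl

module _ {A B : Set} (disjoint : ¬ (A × B)) where

  filled-cell : (a? : Dec A) (b? : Dec B) (k : ℕ) → 𝟙 (filled (cell a? b? k)) ≡ 𝟙 (does a?) + 𝟙 (does b?)
  filled-cell (yes a) (yes b) k = contradiction (a , b) disjoint
  filled-cell (yes _) (no _)  k = refl
  filled-cell (no _)  (yes _) k = refl
  filled-cell (no _)  (no _)  k = refl

  negative-cell : (a? : Dec A) (b? : Dec B) (k : ℕ) → 𝟙 (negative (cell a? b? k)) ≡ 𝟙 (does b?)
  negative-cell (yes a) (yes b) k = contradiction (a , b) disjoint
  negative-cell (yes _) (no _)  k = refl
  negative-cell (no _)  (yes _) k = refl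
  negative-cell (no _)  (no _)  k = refl

  val-cell : (a? : Dec A) (b? : Dec B) (k : ℕ) →
             val (cell a? b? k) ≡ ℤ.+ (𝟙 (does a?) * suc k) ℤ.- ℤ.+ (𝟙 (does b?) * suc k)
  val-cell (yes a) (yes b) k = contradiction (a , b) disjoint
  val-cell (yes _) (no _)  k = sym (trans (ℤₚ.+-identityʳ _) (cong ℤ.+_ (ℕₚ.*-identityˡ (suc k))))
  val-cell (no _)  (yes _) k =
    sym (trans (ℤₚ.+-identityˡ _) (cong (λ x → ℤ.- ℤ.+ x) (ℕₚ.*-identityˡ (suc k))))
  val-cell (no _)  (no _)  k = refl

  isJust⁻-cell : (a? : Dec A) (b? : Dec B) (k k′ : ℕ) →
                 𝟙 (isJust≡ -[1+ k′ ] (cell a? b? k)) ≡ 𝟙 (does b?) * 𝟙 (does (k ℕₚ.≟ k′))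
  isJust⁻-cell (yes a) (yes b) k k′ = contradiction (a , b) disjoint
  isJust⁻-cell (yes _) (no _)  k k′ = refl
  isJust⁻-cell (no _)  (yes _) k k′ =
    trans (cong 𝟙 (isYes≗does (-[1+ k ] ℤₚ.≟ -[1+ k′ ]))) (sym (ℕₚ.+-identityʳ _))
  isJust⁻-cell (no _)  (no _)  k k′ = refl

∣cell∣ : {A B : Set} (a? : Dec A) (b? : Dec B) (k : ℕ) {x : ℤ} → cell a? b? k ≡ just x → ℤ.∣ x ∣ ≡ suc k
∣cell∣ (yes _) _       k refl = refl
∣cell∣ (no _)  (yes _) k refl = refl

module _ {l : ℕ} {A B : Fin l → Set} (a? : ∀ t → Dec (A t)) (b? : ∀ t → Dec (B t)) (k : Fin l → ℕ) where

  count-positive : count (λ t → positive (cell (a? t) (b? t) (k t))) ≡ ∑[ t < l ] 𝟙 (does (a? t))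
  count-positive = trans (count≡∑ (λ t → positive (cell (a? t) (b? t) (k t))))
                         (sum-cong-≗ (λ t → positive-cell (a? t) (b? t) (k t)))

  module _ (disjoint : ∀ t → ¬ (A t × B t)) where

    count-negative : count (λ t → negative (cell (a? t) (b? t) (k t))) ≡ ∑[ t < l ] 𝟙 (does (b? t))
    count-negative = trans (count≡∑ (λ t → negative (cell (a? t) (b? t) (k t))))
                           (sum-cong-≗ (λ t → negative-cell (disjoint t) (a? t) (b? t) (k t)))

    count-filled : count (λ t → filled (cell (a? t) (b? t) (k t))) ≡
                   ∑[ t < l ] 𝟙 (does (a? t)) + ∑[ t < l ] 𝟙 (does (b? t))
    count-filled = trans (count≡∑ (λ t → filled (cell (a? t) (b? t) (k t))))
      (trans (sum-cong-≗ (λ t → filled-cell (disjoint t) (a? t) (b? t) (k t)))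
             (∑-distrib-+ (λ t → 𝟙 (does (a? t))) (λ t → 𝟙 (does (b? t)))))

    sum-val : sumF (λ t → val (cell (a? t) (b? t) (k t))) ≡
              ℤ.+ ∑[ t < l ] (𝟙 (does (a? t)) * suc (k t)) ℤ.- ℤ.+ ∑[ t < l ] (𝟙 (does (b? t)) * suc (k t))
    sum-val = sumF-⊖ _ (λ t → 𝟙 (does (a? t)) * suc (k t)) (λ t → 𝟙 (does (b? t)) * suc (k t))
                       (λ t → val-cell (disjoint t) (a? t) (b? t) (k t))

∑∑-δ-toℕ : (f : Fin n → Fin m) {k : ℕ} → k < n →
           ∑[ i < m ] ∑[ j < n ] (δ i (f j) * 𝟙 (does (toℕ j ℕₚ.≟ k))) ≡ 1
∑∑-δ-toℕ f {k} k<n = trans (∑-comm (λ i j → δ i (f j) * 𝟙 (does (toℕ j ℕₚ.≟ k))))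
                           (trans (sum-cong-≗ (λ j → ∑-δ-* (f j) _)) (∑-δ-toℕ k<n))

≡⇒⊖≡0 : ∀ {x y} → x ≡ y → ℤ.+ x ℤ.- ℤ.+ y ≡ +0
≡⇒⊖≡0 {x} refl = ℤₚ.+-inverseʳ (ℤ.+ x)

toArray : BalancedPairing m n h → Array m n
toArray P i j = cell (i ≟ pos P j) (i ≟ neg P j) (toℕ j)

ShiftableSMR : ℕ → ℕ → ℕ → Set
ShiftableSMR m n r = Σ (Array m n) λ A → IsSMR m n r 2 A × Shiftable A

module _ (P : BalancedPairing m n h) where
  private
    disjoint : ∀ {i j} → ¬ (i ≡ pos P j × i ≡ neg P j)
    disjoint {j = j} (e₁ , e₂) = separated P j (trans (sym e₁) e₂)

  n≡m*h : n ≡ m * h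
  n≡m*h = begin
    n                                     ≡⟨ sym (trans (∑-const n 1) (ℕₚ.*-identityʳ n)) ⟩
    ∑[ j < n ] 1                          ≡⟨ sum-cong-≗ (λ j → sym (∑-δ (pos P j))) ⟩
    ∑[ j < n ] ∑[ i < m ] δ i (pos P j)   ≡⟨ ∑-comm (λ j i → δ i (pos P j)) ⟩
    ∑[ i < m ] degree (pos P) i           ≡⟨ sum-cong-≗ (pos-regular P) ⟩
    ∑[ i < m ] h                          ≡⟨ ∑-const m h ⟩
    m * h                                 ∎
    where open ≡-Reasoning

  mr/2≡n : (m * (2 * h)) / 2 ≡ n
  mr/2≡n = trans (cong (_/ 2) (reorder m h)) (trans (m*n/n≡m (m * h) 2) (sym n≡m*h))
    where
    reorder : ∀ m h → m * (2 * h) ≡ m * h * 2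
    reorder = solve-∀

  private
    A : Array m n
    A = toArray P
    occurs : ℤ → Fin m → Fin n → ℕ
    occurs x i j = 𝟙 (isJust≡ x (A i j))

    inRow⁺ : ∀ i j → Dec (i ≡ pos P j)
    inRow⁺ i j = i ≟ pos P j
    inRow⁻ : ∀ i j → Dec (i ≡ neg P j)
    inRow⁻ i j = i ≟ neg P j

    occurs-once : ∀ {x k} (f : Fin n → Fin m) → k < n →
                  (∀ i j → occurs x i j ≡ δ i (f j) * 𝟙 (does (toℕ j ℕₚ.≟ k))) →
                  sumF (λ i → ℤ.+ count (λ j → isJust≡ x (A i j))) ≡ ℤ.+ 1
    occurs-once {x} f k<n occurs≡ = trans (sumF-+ (λ i → count (λ j → isJust≡ x (A i j)))) (cong ℤ.+_ (trans
      (sum-cong-≗ (λ i → trans (count≡∑ (λ j → isJust≡ x (A i j))) (sum-cong-≗ (occurs≡ i))))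
      (∑∑-δ-toℕ f k<n)))

    symbol-once : ∀ x → InX n x → sumF (λ i → ℤ.+ count (λ j → isJust≡ x (A i j))) ≡ ℤ.+ 1
    symbol-once (ℤ.+ zero)  (() , _)
    symbol-once (ℤ.+ suc k) (_ , k<n) =
      occurs-once (pos P) k<n (λ i j → isJust⁺-cell (inRow⁺ i j) (inRow⁻ i j) (toℕ j) k)
    symbol-once -[1+ k ]    (_ , k<n) =
      occurs-once (neg P) k<n (λ i j → isJust⁻-cell disjoint (inRow⁺ i j) (inRow⁻ i j) (toℕ j) k)

    entry-bounded : ∀ i j x → A i j ≡ just x → InX n x
    entry-bounded i j x e =
      subst (λ a → 1 ℕ.≤ a × a ℕ.≤ n) (sym (∣cell∣ (inRow⁺ i j) (inRow⁻ i j) (toℕ j) e)) (s≤s z≤n , toℕ<n j)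

  toArray-isSMR : IsSMR m n (2 * h) 2 (toArray P)
  toArray-isSMR = record
    { rowFilled  = λ i → trans (count-filled (inRow⁺ i) (inRow⁻ i) toℕ (λ _ → disjoint))
                            (trans (cong₂ _+_ (pos-regular P i) (neg-regular P i))
                                   (cong (h +_) (sym (ℕₚ.+-identityʳ h))))
    ; colFilled  = λ j → trans (count-filled (λ i → inRow⁺ i j) (λ i → inRow⁻ i j) (λ _ → toℕ j) (λ _ → disjoint))
                            (cong₂ _+_ (∑-δ (pos P j)) (∑-δ (neg P j)))
    ; entriesInX = λ i j x e → subst (λ N → InX N x) (sym mr/2≡n) (entry-bounded i j x e)
    ; eachOnce   = λ x x∈X → symbol-once x (subst (λ N → InX N x) mr/2≡n x∈X)
    ; rowSum     = λ i → trans (sum-val (inRow⁺ i) (inRow⁻ i) toℕ (λ _ → disjoint)) (≡⇒⊖≡0 (balanced P i))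
    ; colSum     = λ j → trans (sum-val (λ i → inRow⁺ i j) (λ i → inRow⁻ i j) (λ _ → toℕ j) (λ _ → disjoint))
                            (≡⇒⊖≡0 (trans (∑-δ-* (pos P j) (label j)) (sym (∑-δ-* (neg P j) (label j)))))
    }

  toArray-shiftable : Shiftable (toArray P)
  toArray-shiftable = record
    { rowBal = λ i → trans (count-positive (inRow⁺ i) (inRow⁻ i) toℕ)
        (trans (pos-regular P i)
          (sym (trans (count-negative (inRow⁺ i) (inRow⁻ i) toℕ (λ _ → disjoint)) (neg-regular P i))))
    ; colBal = λ j → trans (count-positive (λ i → inRow⁺ i j) (λ i → inRow⁻ i j) (λ _ → toℕ j))
        (trans (∑-δ (pos P j))
          (sym (trans (count-negative (λ i → inRow⁺ i j) (λ i → inRow⁻ i j) (λ _ → toℕ j) (λ _ → disjoint))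
                      (∑-δ (neg P j)))))
    }

balanced⇒shiftableSMR : BalancedPairing m n h → ShiftableSMR m n (2 * h)
balanced⇒shiftableSMR P = toArray P , toArray-isSMR P , toArray-shiftable P

cast : ∀ {m′ n′ r r′} → m ≡ m′ → n ≡ n′ → r ≡ r′ → ShiftableSMR m n r → ShiftableSMR m′ n′ r′
cast refl refl refl A = A

construction : ∀ a b → BalancedPairing (6 + b * 4) ((18 + a * 12) + b * (12 + a * 8)) (3 + a * 2)
construction a b = (B66 ‖ ‖-power a B64) ⊞ ⊞-power b (B46 ‖ ‖-power a B44)

lemma18 : (a b : ℕ) → a ≥ 1 → b ≥ 1 →
    Σ (Array (4 * b + 2) ((2 * a + 1) * (4 * b + 2))) (λ A →
      IsSMR (4 * b + 2) ((2 * a + 1) * (4 * b + 2)) (4 * a + 2) 2 A × Shiftable A)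
lemma18 (suc a) (suc b) (s≤s z≤n) (s≤s z≤n) =
  cast (rows b) (columns a b) (perRow a) (balanced⇒shiftableSMR (construction a b))
  where
  rows : ∀ b → 6 + b * 4 ≡ 4 * suc b + 2
  rows = solve-∀
  columns : ∀ a b → 18 + a * 12 + b * (12 + a * 8) ≡ (2 * suc a + 1) * (4 * suc b + 2)
  columns = solve-∀
  perRow : ∀ a → 2 * (3 + a * 2) ≡ 4 * suc a + 2
  perRow = solve-∀
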